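{- Let $\mathcal{M}=(V,E,F)$ be a finite map with Euler characteristic $\chi(\mathcal{M})=|V|-|E|+|F|$, and let $G$ be a subgroup of $\mathrm{Aut}(\mathcal{M})$. Assume that $\gcd(\chi(\mathcal{M}),|E|)=1$. Then: (1) $\gcd(\chi(\mathcal{M}),|G|)$ divides $4$, and $\gcd(\chi(\mathcal{M}),|G|)\neq 1$ only if $|E|$ is odd; (2) each Sylow subgroup of $G$ is cyclic or dihedral; (3) $|G|=\mathrm{lcm}\{|G_\omega| : \omega\in V\cup E\cup F\}$, where $G_\omega$ denotes the stabilizer of $\omega$ in $G$.
   Context: A map is a $2$-cell embedding of a finite connected graph (vertex set $V$, edge set $E$) into a closed surface, with face set $F$; maps are assumed to have no loops. A flag is an incident triple (vertex, edge, face); each edge lies in exactly $4$ flags. An automorphism of $\mathcal{M}$ is a permutation of the flags preserving all incidence relations; these form the group $\mathrm{Aut}(\mathcal{M})$, which acts on $V$, $E$ and $F$. Dihedral groups include $\mathbb{Z}_2^2=\mathrm{D}_4$ (and $\mathbb{Z}_2=\mathrm{D}_2$). -}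

module Defs where

open import Data.Nat using (ℕ; zero; suc; _*_; _^_)
open import Data.Nat.Divisibility using (_∣_)
open import Data.Nat.GCD using (gcd)
open import Data.Nat.LCM using (lcm)
open import Data.Nat.Primality using (Prime)
open import Data.Integer as ℤ using (ℤ; +_)
open import Data.Fin using (Fin; _≟_)
open import Data.List using (List; []; _∷_; length; filter; foldr; map; concatMap)
open import Data.List.Membership.Propositional using (_∈_)
open import Data.Product using (Σ; ∃; _×_; _,_)
open import Data.Sum using (_⊎_)
open import Data.Empty using (⊥)
open import Relation.Nullary using (¬_)
open import Relation.Binary.PropositionalEquality using (_≡_; _≢_)
open import Function using (_∘_; id; _⇔_)
open import Relation.Binary.PropositionalEquality using (_≗_)
open import Data.List.Base using (allFin)

-- Combinatorial description of maps via flags (Jones–Singerman / Lins):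
-- flags are Fin n; r₀ changes the vertex, r₁ the edge, r₂ the face
-- of a flag, keeping the other two components.

-- x and y lie in the same orbit of the group generated by the given
-- permutations (all generators here are involutions, so this
-- reachability relation is the orbit relation).
data Reach {n : ℕ} (gs : List (Fin n → Fin n)) : Fin n → Fin n → Set where
  here : ∀ {x} → Reach gs x x
  step : ∀ {g x y} → g ∈ gs → Reach gs (g x) y → Reach gs x y

record Map : Set where
  field
    nFlags : ℕ
    r₀ r₁ r₂ : Fin nFlags → Fin nFlags
    r₀-inv : ∀ x → r₀ (r₀ x) ≡ x
    r₁-inv : ∀ x → r₁ (r₁ x) ≡ x
    r₂-inv : ∀ x → r₂ (r₂ x) ≡ x
    r₀-fpf : ∀ x → r₀ x ≢ x
    r₁-fpf : ∀ x → r₁ x ≢ x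
    r₂-fpf : ∀ x → r₂ x ≢ x
    r₀r₂-comm : ∀ x → r₀ (r₂ x) ≡ r₂ (r₀ x)
    r₀r₂-fpf  : ∀ x → r₀ (r₂ x) ≢ x          -- each edge lies in exactly 4 flags
    connected : ∀ x y → Reach (r₀ ∷ r₁ ∷ r₂ ∷ []) x y
    nV : ℕ
    vtx : Fin nFlags → Fin nV
    vtx-surj : ∀ v → ∃ λ x → vtx x ≡ v
    vtx-spec : ∀ x y → (vtx x ≡ vtx y) ⇔ Reach (r₁ ∷ r₂ ∷ []) x y
    nE : ℕ
    edge : Fin nFlags → Fin nE
    edge-surj : ∀ e → ∃ λ x → edge x ≡ e
    edge-spec : ∀ x y → (edge x ≡ edge y) ⇔ Reach (r₀ ∷ r₂ ∷ []) x y
    nF : ℕ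
    face : Fin nFlags → Fin nF
    face-surj : ∀ f → ∃ λ x → face x ≡ f
    face-spec : ∀ x y → (face x ≡ face y) ⇔ Reach (r₀ ∷ r₁ ∷ []) x y
    no-loops : ∀ x → vtx (r₀ x) ≢ vtx x

module _ (M : Map) where
  open Map M

  χ : ℤ
  χ = (+ nV ℤ.- + nE) ℤ.+ + nF

  IsAut : (Fin nFlags → Fin nFlags) → Set
  IsAut σ = (∃ λ τ → (σ ∘ τ) ≗ id × (τ ∘ σ) ≗ id)
          × (σ ∘ r₀) ≗ (r₀ ∘ σ) × (σ ∘ r₁) ≗ (r₁ ∘ σ) × (σ ∘ r₂) ≗ (r₂ ∘ σ)

  -- a (finite) subgroup of Aut(M), listed without repetition as el : Fin order → Aut(M)
  record AutSubgroup : Set where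
    field
      order : ℕ
      el : Fin order → Fin nFlags → Fin nFlags
      el-aut : ∀ i → IsAut (el i)
      el-inj : ∀ i j → el i ≗ el j → i ≡ j
      id-mem : ∃ λ i → el i ≗ id
      comp-mem : ∀ i j → ∃ λ k → el k ≗ (el i ∘ el j)
      inv-mem : ∀ i → ∃ λ j → (el j ∘ el i) ≗ id
  open AutSubgroup public

  _⊆G_ : AutSubgroup → AutSubgroup → Set
  H ⊆G G = ∀ i → ∃ λ j → el H i ≗ el G j

  pow : (Fin nFlags → Fin nFlags) → ℕ → Fin nFlags → Fin nFlags
  pow g zero = id
  pow g (suc k) = g ∘ pow g k

  IsSylow : ℕ → AutSubgroup → AutSubgroup → Set
  IsSylow p G H = Prime p × H ⊆G G ×
    (∃ λ a → order H ≡ p ^ a × (p ^ a) ∣ order G × ¬ ((p ^ suc a) ∣ order G))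

  IsCyclic : AutSubgroup → Set
  IsCyclic H = ∃ λ g → ∀ j → ∃ λ k → el H j ≗ pow (el H g) k

  -- H ≅ D_{2m} = ⟨ρ, τ | ρ^m = τ² = (τρ)² = 1⟩ with |H| = 2m
  -- (m = 1 gives D₂ = ℤ₂, m = 2 gives D₄ = ℤ₂²)
  IsDihedral : AutSubgroup → Set
  IsDihedral H = ∃ λ m → order H ≡ 2 * m × (∃ λ ρ → ∃ λ τ →
      pow (el H ρ) m ≗ id
    × (el H τ ∘ el H τ) ≗ id
    × (el H τ ∘ el H ρ ∘ el H τ ∘ el H ρ) ≗ id
    × (∀ j → ∃ λ k → el H j ≗ pow (el H ρ) k ⊎ el H j ≗ (pow (el H ρ) k ∘ el H τ)))

  -- |G_ω| for ω the vertex / edge / face of flag x: number of g ∈ G with g(ω) = ω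
  -- (the action of G on V, E, F is the one induced from the action on flags)
  stabV stabE stabF : AutSubgroup → Fin nFlags → ℕ
  stabV G x = length (filter (λ i → vtx (el G i x) ≟ vtx x) (allFin (order G)))
  stabE G x = length (filter (λ i → edge (el G i x) ≟ edge x) (allFin (order G)))
  stabF G x = length (filter (λ i → face (el G i x) ≟ face x) (allFin (order G)))

  -- lcm { |G_ω| : ω ∈ V ∪ E ∪ F }  (every ω is the vertex/edge/face of some flag)
  lcmStab : AutSubgroup → ℕ
  lcmStab G = foldr lcm 1
    (concatMap (λ x → stabV G x ∷ stabE G x ∷ stabF G x ∷ []) (allFin nFlags))

{-# OPTIONS --safe #-}
module Submission where

-- Every automorphism is determined by the image of one flag, so G acts freely on flags and
-- |G| = |orbit of ω| · |G_ω| for every vertex, edge and face ω.  An edge has four flags, permuted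
-- freely by G_e, and the flags reached form a subgroup of ⟨r₀, r₂⟩ ≅ ℤ₂², so |G_e| divides 4.
-- (1) Summing over the edge orbits, gcd(χ, |G|) divides 4|E|, hence 4; if it is not 1 it is even,
--     so |E| is odd.
-- (2) If a p-subgroup fixes no vertex, edge or face, p divides every orbit length, hence |V|, |E|
--     and |F|, and so p divides gcd(χ, |E|) = 1.  A fixed cell is a cycle of flags alternately
--     joined by its two generating involutions a and b; the subgroup acts freely on it, so it is
--     generated by the element ρ moving x the fewest steps along the cycle, possibly together with
--     a reflection t, and is cyclic or dihedral.
-- (3) With |G| = t · lcm |G_ω|, t divides every orbit length |G| / |G_ω|, hence |V|, |E| and |F|,
--     so t = 1 as in (2).

open import Defs
open import Data.Nat using (ℕ; zero; suc; _+_; _*_; _∸_; _^_; _≤_; _<_; z≤n; s≤s; s≤s⁻¹; NonZero; >-nonZero; nonTrivial⇒≢1)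
open import Data.Nat.Properties
  using (+-identityʳ; +-comm; +-suc; *-identityˡ; *-suc; *-comm; *-distribʳ-+; +-*-semiring;
         ≤-refl; ≤-antisym; ≤-<-trans; <⇒≤; <-cmp; _<?_; n<1+n; m≤n⇒m<n∨m≡n; m∸n≤m; m∸n+n≡m; m+[n∸m]≡n; m<n⇒0<n∸m)
import Data.Nat.Properties as ℕ
open import Data.Nat.Divisibility
  using (_∣_; divides; _∣?_; _∣0; 1∣_; ∣1⇒≡1; ∣-trans; ∣m∣n⇒∣m+n; *-monoʳ-∣; *-cancelʳ-∣)
open import Data.Nat.DivMod using (_%_; _/_; m≡m%n+[m/n]*n; m%n<n)
open import Data.Nat.GCD using (gcd; gcd[m,n]∣m; gcd[m,n]∣n)
open import Data.Nat.LCM using (lcm; m∣lcm[m,n]; n∣lcm[m,n]; lcm-least)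
open import Data.Nat.Coprimality using (Coprime; gcd≡1⇒coprime; coprime-divisor)
open import Data.Nat.Primality using (Prime; prime[2]; prime⇒irreducible; prime⇒nonTrivial)
open import Data.Integer using (∣_∣)
import Data.Integer as ℤ
open import Data.Integer.Divisibility.Signed using (∣ᵤ⇒∣; ∣⇒∣ᵤ) renaming (∣m∣n⇒∣m+n to ∣m∣n⇒∣m+nℤ; ∣m∣n⇒∣m-n to ∣m∣n⇒∣m-nℤ)
open import Data.Fin using (Fin; zero; suc; toℕ; fromℕ<; splitAt; join; _≟_)
open import Data.Fin.Properties
  using (suc-injective; any?; all?; ¬∀⟶∃¬; pigeonhole; injective⇒≤; toℕ-injective; toℕ<n; toℕ-fromℕ<; splitAt-join; join-splitAt)
open import Data.Fin.Permutation using (Permutation; permutation; _⟨$⟩ʳ_)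
open import Data.List as List using (List; []; _∷_; length; filter; tabulate; allFin; foldr)
open import Data.List.Properties using (length-tabulate; filter-none; filter-complete; filter-notAll; filter-some; filter-reject; filter-≐)
open import Data.List.Relation.Unary.Any using (here; there; satisfied)
open import Data.List.Relation.Unary.All as All using (All; []; _∷_)
open import Data.List.Relation.Unary.Unique.Propositional using (Unique)
open import Data.List.Relation.Unary.AllPairs using ([]; _∷_)
import Data.Nat.ListAction as ListAction
open import Data.List.Membership.Propositional using (_∈_; lose)
open import Data.List.Membership.Propositional.Properties using (∈-filter⁻; ∈-allFin; ∈-concatMap⁺; ∈-concatMap⁻)
open import Data.List.Relation.Binary.Subset.Propositional using (_⊆_)
open import Data.Product using (∃; _×_; _,_; proj₁; proj₂)
open import Data.Sum using (_⊎_; inj₁; inj₂; [_,_]′)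
open import Function using (_∘_; id; _⇔_; mk⇔; Equivalence)
open import Level using (0ℓ)
open import Relation.Nullary using (¬_; Dec; yes; no; contradiction)
open import Relation.Nullary.Decidable using (_×-dec_)
open import Relation.Unary using (Pred; Decidable; _≐_)
open import Relation.Unary.Properties using (∁?)
open import Relation.Binary using (Rel; IsEquivalence; tri<; tri≈; tri>) renaming (Decidable to Decidable₂)
open import Relation.Binary.PropositionalEquality
open import Induction.WellFounded using (Acc; acc)
open import Data.Nat.Induction using (<-wellFounded)
open import Algebra.Properties.CommutativeMonoid.Sum ℕ.+-0-commutativeMonoid
  using (sum; sum-cong-≗; sum-replicate-zero; sum-permute; ∑-distrib-+)
open import Algebra.Properties.Semiring.Sum +-*-semiring using (*-distribʳ-sum)
open import Algebra.Properties.CommutativeSemigroup ℕ.+-commutativeSemigroup using () renaming (interchange to +-interchange)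

open ≡-Reasoning

indicator : {P : Set} → Dec P → ℕ
indicator (yes _) = 1
indicator (no _) = 0

indicator-yes : {P : Set} (p : Dec P) → P → indicator p ≡ 1
indicator-yes (yes _) _ = refl
indicator-yes (no ¬p) p = contradiction p ¬p

indicator-no : {P : Set} (p : Dec P) → ¬ P → indicator p ≡ 0
indicator-no (yes p) ¬p = contradiction p ¬p
indicator-no (no _) _ = refl

indicator-cong : {P Q : Set} (p : Dec P) (q : Dec Q) → P ⇔ Q → indicator p ≡ indicator q
indicator-cong (yes p) q P⇔Q = sym (indicator-yes q (Equivalence.to P⇔Q p))
indicator-cong (no ¬p) q P⇔Q = sym (indicator-no q (¬p ∘ Equivalence.from P⇔Q))

module _ {A : Set} {P : Pred A 0ℓ} (P? : Decidable P) where

  length-filter-∷ : ∀ x xs → length (filter P? (x ∷ xs)) ≡ indicator (P? x) + length (filter P? xs)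
  length-filter-∷ x xs with P? x
  ... | yes _ = refl
  ... | no _ = refl

  length-filter-tabulate : ∀ {n} (f : Fin n → A) → length (filter P? (tabulate f)) ≡ sum (indicator ∘ P? ∘ f)
  length-filter-tabulate {zero} f = refl
  length-filter-tabulate {suc n} f =
    trans (length-filter-∷ (f zero) (tabulate (f ∘ suc)))
          (cong (indicator (P? (f zero)) +_) (length-filter-tabulate (f ∘ suc)))

  length-filter-∁ : ∀ xs → length (filter P? xs) + length (filter (∁? P?) xs) ≡ length xs
  length-filter-∁ [] = refl
  length-filter-∁ (x ∷ xs) with P? x
  ... | yes _ = cong suc (length-filter-∁ xs)
  ... | no _ = trans (+-suc _ _) (cong suc (length-filter-∁ xs))

module _ {A : Set} {P Q R : Pred A 0ℓ} (P? : Decidable P) (Q? : Decidable Q) (R? : Decidable R)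
         (P⇔Q⊎R : ∀ x → P x ⇔ (Q x ⊎ R x)) (disjoint : ∀ {x} → Q x → ¬ R x) where

  indicator-⊎ : ∀ x → indicator (P? x) ≡ indicator (Q? x) + indicator (R? x)
  indicator-⊎ x with P? x | Q? x | R? x
  ... | _     | yes q | yes r = contradiction r (disjoint q)
  ... | yes _ | yes _ | no _  = refl
  ... | yes _ | no _  | yes _ = refl
  ... | yes p | no ¬q | no ¬r = contradiction (Equivalence.to (P⇔Q⊎R x) p) [ ¬q , ¬r ]′
  ... | no ¬p | yes q | no _  = contradiction (Equivalence.from (P⇔Q⊎R x) (inj₁ q)) ¬p
  ... | no ¬p | no _  | yes r = contradiction (Equivalence.from (P⇔Q⊎R x) (inj₂ r)) ¬p
  ... | no _  | no _  | no _  = refl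

  length-filter-⊎ : ∀ xs → length (filter P? xs) ≡ length (filter Q? xs) + length (filter R? xs)
  length-filter-⊎ [] = refl
  length-filter-⊎ (x ∷ xs) = begin
    length (filter P? (x ∷ xs))
      ≡⟨ length-filter-∷ P? x xs ⟩
    indicator (P? x) + length (filter P? xs)
      ≡⟨ cong₂ _+_ (indicator-⊎ x) (length-filter-⊎ xs) ⟩
    (indicator (Q? x) + indicator (R? x)) + (length (filter Q? xs) + length (filter R? xs))
      ≡⟨ +-interchange (indicator (Q? x)) _ _ _ ⟩
    (indicator (Q? x) + length (filter Q? xs)) + (indicator (R? x) + length (filter R? xs))
      ≡⟨ sym (cong₂ _+_ (length-filter-∷ Q? x xs) (length-filter-∷ R? x xs)) ⟩
    length (filter Q? (x ∷ xs)) + length (filter R? (x ∷ xs)) ∎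

module _ {A : Set} {P Q : Pred A 0ℓ} (P? : Decidable P) (Q? : Decidable Q) (P⇒Q : ∀ {x} → P x → Q x) where

  filter-absorb : ∀ xs → filter P? (filter Q? xs) ≡ filter P? xs
  filter-absorb [] = refl
  filter-absorb (x ∷ xs) with Q? x
  ... | no ¬q = trans (filter-absorb xs) (sym (filter-reject P? (¬q ∘ P⇒Q)))
  ... | yes _ with P? x
  ...   | yes _ = cong (x ∷_) (filter-absorb xs)
  ...   | no _ = filter-absorb xs

module _ {A : Set} {R : Rel A 0ℓ} (R? : Decidable₂ R) (R-equivalence : IsEquivalence R)
         (Q : ℕ → Set) (Q-zero : Q 0) (Q-+ : ∀ {k l} → Q k → Q l → Q (k + l)) where
  open IsEquivalence R-equivalence renaming (refl to R-refl; sym to R-sym; trans to R-trans)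

  additive-over-classes : ∀ xs → (∀ {x} → x ∈ xs → Q (length (filter (R? x) xs))) → Q (length xs)
  additive-over-classes xs = go xs (<-wellFounded (length xs))
    where
    go : ∀ xs → Acc _<_ (length xs) → (∀ {x} → x ∈ xs → Q (length (filter (R? x) xs))) → Q (length xs)
    go [] _ _ = Q-zero
    go (y ∷ ys) (acc smaller) classes =
      subst Q (length-filter-∁ (R? y) (y ∷ ys)) (Q-+ (classes (here refl)) (go rest (smaller shorter) rest-classes))
      where
      rest : List A
      rest = filter (∁? (R? y)) (y ∷ ys)
      shorter : length rest < length (y ∷ ys)
      shorter = filter-notAll (∁? (R? y)) (y ∷ ys) (here (λ ¬Ryy → ¬Ryy R-refl))
      rest-classes : ∀ {z} → z ∈ rest → Q (length (filter (R? z) rest))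
      rest-classes {z} z∈rest with z∈ys , ¬Ryz ← ∈-filter⁻ (∁? (R? y)) z∈rest =
        subst Q (cong length (sym (filter-absorb (R? z) (∁? (R? y)) (λ Rzw Ryw → ¬Ryz (R-trans Ryw (R-sym Rzw))) (y ∷ ys))))
              (classes z∈ys)

∑-indicator-≟ : ∀ {N} (v : Fin N) → sum (λ w → indicator (v ≟ w)) ≡ 1
∑-indicator-≟ {suc N} zero =
  cong suc (trans (sum-cong-≗ {N} (λ w → indicator-no (zero ≟ suc w) (λ ()))) (sum-replicate-zero N))
∑-indicator-≟ {suc N} (suc v) = begin
  indicator (suc v ≟ zero) + sum (λ w → indicator (suc v ≟ suc w))
    ≡⟨ cong₂ _+_ (indicator-no (suc v ≟ zero) (λ ()))
                 (sum-cong-≗ {N} (λ w → indicator-cong (suc v ≟ suc w) (v ≟ w) (mk⇔ suc-injective (cong suc)))) ⟩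
  sum (λ w → indicator (v ≟ w))
    ≡⟨ ∑-indicator-≟ v ⟩
  1 ∎

∑-length-fibres : ∀ {A : Set} {N} (φ : A → Fin N) xs → sum (λ w → length (filter (λ a → φ a ≟ w) xs)) ≡ length xs
∑-length-fibres {N = N} φ [] = sum-replicate-zero N
∑-length-fibres {N = N} φ (x ∷ xs) = begin
  sum (λ w → length (filter (λ a → φ a ≟ w) (x ∷ xs)))
    ≡⟨ sum-cong-≗ {N} (λ w → length-filter-∷ (λ a → φ a ≟ w) x xs) ⟩
  sum (λ w → indicator (φ x ≟ w) + length (filter (λ a → φ a ≟ w) xs))
    ≡⟨ ∑-distrib-+ (λ w → indicator (φ x ≟ w)) _ ⟩
  sum (λ w → indicator (φ x ≟ w)) + sum (λ w → length (filter (λ a → φ a ≟ w) xs))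
    ≡⟨ cong₂ _+_ (∑-indicator-≟ (φ x)) (∑-length-fibres φ xs) ⟩
  suc (length xs) ∎

length-filter-permute : ∀ {n} {P Q : Pred (Fin n) 0ℓ} (P? : Decidable P) (Q? : Decidable Q) (π : Permutation n n) →
  (∀ i → P i ⇔ Q (π ⟨$⟩ʳ i)) → length (filter P? (allFin n)) ≡ length (filter Q? (allFin n))
length-filter-permute {n} P? Q? π P⇔Qπ = begin
  length (filter P? (allFin n))       ≡⟨ length-filter-tabulate P? id ⟩
  sum (indicator ∘ P?)                ≡⟨ sum-cong-≗ (λ i → indicator-cong (P? i) (Q? (π ⟨$⟩ʳ i)) (P⇔Qπ i)) ⟩
  sum (indicator ∘ Q? ∘ (π ⟨$⟩ʳ_))    ≡⟨ sym (sum-permute (indicator ∘ Q?) π) ⟩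
  sum (indicator ∘ Q?)                ≡⟨ sym (length-filter-tabulate Q? id) ⟩
  length (filter Q? (allFin n))       ∎

module _ {A : Set} {N : ℕ} (φ : A → Fin N) where
  open import Data.List.Membership.DecPropositional (_≟_ {N}) using (_∈?_)

  length-filter-∈ : ∀ {ys} → Unique ys → ∀ xs →
    length (filter (λ a → φ a ∈? ys) xs) ≡ ListAction.sum (List.map (λ y → length (filter (λ a → φ a ≟ y) xs)) ys)
  length-filter-∈ [] xs = cong length (filter-none (λ a → φ a ∈? []) {xs} (All.tabulate (λ _ ())))
  length-filter-∈ {y ∷ ys} (y∉ys ∷ unique) xs =
    trans (length-filter-⊎ (λ a → φ a ∈? y ∷ ys) (λ a → φ a ≟ y) (λ a → φ a ∈? ys)
                           (λ a → mk⇔ split [ here , there ]′) disjoint xs)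
          (cong (length (filter (λ a → φ a ≟ y) xs) +_) (length-filter-∈ unique xs))
    where
    split : ∀ {z} → z ∈ y ∷ ys → z ≡ y ⊎ z ∈ ys
    split (here z≡y) = inj₁ z≡y
    split (there z∈ys) = inj₂ z∈ys
    disjoint : ∀ {a} → φ a ≡ y → ¬ φ a ∈ ys
    disjoint φa≡y φa∈ys = All.lookup y∉ys φa∈ys (sym φa≡y)

module _ {P : ℕ → Set} (P? : ∀ k → Dec (P k)) where
  private
    Least : ℕ → Set
    Least k = P k × (∀ {j} → j < k → ¬ P j)

    search : ∀ m → ∃ Least ⊎ (∀ {j} → j < m → ¬ P j)
    search zero = inj₂ λ ()
    search (suc m) with search m
    ... | inj₁ found = inj₁ found
    ... | inj₂ none with P? m
    ...   | yes pm = inj₁ (m , pm , none)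
    ...   | no ¬pm = inj₂ λ j<1+m → [ none , (λ { refl → ¬pm }) ]′ (m≤n⇒m<n∨m≡n (s≤s⁻¹ j<1+m))

  least-witness : ∀ m → P m → ∃ λ k → P k × (∀ {j} → j < k → ¬ P j)
  least-witness m pm with search (suc m)
  ... | inj₁ found = found
  ... | inj₂ none = contradiction pm (none ≤-refl)

prime-power-divisor : ∀ {p d} → Prime p → ∀ a → d ∣ p ^ a → d ≡ 1 ⊎ p ∣ d
prime-power-divisor p-prime zero d∣1 = inj₁ (∣1⇒≡1 d∣1)
prime-power-divisor {p} {d} p-prime (suc a) d∣p^1+a with p ∣? d
... | yes p∣d = inj₂ p∣d
... | no p∤d = prime-power-divisor p-prime a (coprime-divisor d-coprime-p d∣p^1+a)
  where
  d-coprime-p : Coprime d p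
  d-coprime-p {k} (k∣d , k∣p) with prime⇒irreducible p-prime k∣p
  ... | inj₁ k≡1 = k≡1
  ... | inj₂ refl = contradiction k∣d p∤d

quotient-∣ : ∀ {m s t l} .{{_ : NonZero s}} → m * s ≡ t * l → s ∣ l → t ∣ m
quotient-∣ {m} {s} {t} eq s∣l = *-cancelʳ-∣ s (subst (t * s ∣_) (sym eq) (*-monoʳ-∣ t s∣l))

foldr-lcm-least : ∀ {ks m} → (∀ {k} → k ∈ ks → k ∣ m) → foldr lcm 1 ks ∣ m
foldr-lcm-least {[]} {m} _ = 1∣ m
foldr-lcm-least {k ∷ ks} all∣m = lcm-least (all∣m (here refl)) (foldr-lcm-least (all∣m ∘ there))

∈⇒∣foldr-lcm : ∀ {k ks} → k ∈ ks → k ∣ foldr lcm 1 ks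
∈⇒∣foldr-lcm {ks = k ∷ ks} (here refl) = m∣lcm[m,n] k _
∈⇒∣foldr-lcm {ks = k ∷ ks} (there k∈ks) = ∣-trans (∈⇒∣foldr-lcm k∈ks) (n∣lcm[m,n] k _)

CommutesWith : ∀ {n} → List (Fin n → Fin n) → (Fin n → Fin n) → Set
CommutesWith gs σ = ∀ {g} → g ∈ gs → σ ∘ g ≗ g ∘ σ

module _ {n : ℕ} {gs : List (Fin n → Fin n)} where

  CommutesWith-id : CommutesWith gs id
  CommutesWith-id _ _ = refl

  CommutesWith-∘ : ∀ {σ τ} → CommutesWith gs σ → CommutesWith gs τ → CommutesWith gs (σ ∘ τ)
  CommutesWith-∘ {σ} {τ} σ-comm τ-comm g∈gs y = trans (cong σ (τ-comm g∈gs y)) (σ-comm g∈gs (τ y))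

  Reach-map : ∀ {σ} → CommutesWith gs σ → ∀ {x y} → Reach gs x y → Reach gs (σ x) (σ y)
  Reach-map σ-comm here = here
  Reach-map {σ} σ-comm {x} {y} (step {g} g∈gs r) = step g∈gs (subst (λ z → Reach gs z (σ y)) (σ-comm g∈gs x) (Reach-map σ-comm r))

  Reach-agree : ∀ {σ τ} → CommutesWith gs σ → CommutesWith gs τ → ∀ {x y} → Reach gs x y → σ x ≡ τ x → σ y ≡ τ y
  Reach-agree σ-comm τ-comm here eq = eq
  Reach-agree {σ} {τ} σ-comm τ-comm {x} (step {g} g∈gs r) eq =
    Reach-agree σ-comm τ-comm r (trans (σ-comm g∈gs x) (trans (cong g eq) (sym (τ-comm g∈gs x))))

module _ (M : Map) where
  open Map M

  Flag : Set
  Flag = Fin nFlags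

  generators : List (Flag → Flag)
  generators = r₀ ∷ r₁ ∷ r₂ ∷ []

  Commutes : (Flag → Flag) → Set
  Commutes = CommutesWith generators

  IsAut⇒Commutes : ∀ {σ} → IsAut M σ → Commutes σ
  IsAut⇒Commutes (_ , with-r₀ , _ , _) (here refl) = with-r₀
  IsAut⇒Commutes (_ , _ , with-r₁ , _) (there (here refl)) = with-r₁
  IsAut⇒Commutes (_ , _ , _ , with-r₂) (there (there (here refl))) = with-r₂

  Commutes-determined : ∀ {σ τ} → Commutes σ → Commutes τ → ∀ {x} → σ x ≡ τ x → σ ≗ τ
  Commutes-determined σ-comm τ-comm {x} eq y = Reach-agree σ-comm τ-comm (connected x y) eq

  module _ (f : Flag → Flag) where

    pow-+ : ∀ i j → pow M f (i + j) ≗ pow M f i ∘ pow M f j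
    pow-+ zero j y = refl
    pow-+ (suc i) j y = cong f (pow-+ i j y)

    pow-suc : ∀ k → pow M f (suc k) ≗ pow M f k ∘ f
    pow-suc zero y = refl
    pow-suc (suc k) y = cong f (pow-suc k y)

    pow-injective : (∀ {u v} → f u ≡ f v → u ≡ v) → ∀ k {u v} → pow M f k u ≡ pow M f k v → u ≡ v
    pow-injective f-injective zero eq = eq
    pow-injective f-injective (suc k) eq = pow-injective f-injective k (f-injective eq)

    pow-commute : ∀ σ → σ ∘ f ≗ f ∘ σ → ∀ k → σ ∘ pow M f k ≗ pow M f k ∘ σ
    pow-commute σ σf≗fσ zero y = refl
    pow-commute σ σf≗fσ (suc k) y = trans (σf≗fσ _) (cong f (pow-commute σ σf≗fσ k y))

    pow-*-fixed : ∀ {z} l → pow M f l z ≡ z → ∀ q → pow M f (q * l) z ≡ z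
    pow-*-fixed l fixed zero = refl
    pow-*-fixed {z} l fixed (suc q) = trans (pow-+ l (q * l) z) (trans (cong (pow M f l) (pow-*-fixed l fixed q)) fixed)

    pow-% : ∀ {z} l .{{_ : NonZero l}} → pow M f l z ≡ z → ∀ q → pow M f q z ≡ pow M f (q % l) z
    pow-% {z} l fixed q = begin
      pow M f q z                                  ≡⟨ cong (λ k → pow M f k z) (m≡m%n+[m/n]*n q l) ⟩
      pow M f (q % l + (q / l) * l) z              ≡⟨ pow-+ (q % l) ((q / l) * l) z ⟩
      pow M f (q % l) (pow M f ((q / l) * l) z)    ≡⟨ cong (pow M f (q % l)) (pow-*-fixed l fixed (q / l)) ⟩
      pow M f (q % l) z                            ∎

  CommutesWith-pow : ∀ {gs f} → CommutesWith gs f → ∀ k → CommutesWith gs (pow M f k)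
  CommutesWith-pow {f = f} f-comm k {g} g∈gs y = sym (pow-commute f g (λ z → sym (f-comm g∈gs z)) k y)

  module _ (u v : Flag → Flag) where

    pow-slide : ∀ k → v ∘ pow M (u ∘ v) k ≗ pow M (v ∘ u) k ∘ v
    pow-slide zero y = refl
    pow-slide (suc k) y = cong (v ∘ u) (pow-slide k y)

    pow-reflect : (∀ y → u (u y) ≡ y) → ∀ k → u ∘ pow M (u ∘ v) k ≗ pow M (v ∘ u) k ∘ u
    pow-reflect u-involutive zero y = refl
    pow-reflect u-involutive (suc k) y = begin
      u (u (v (pow M (u ∘ v) k y)))       ≡⟨ u-involutive _ ⟩
      v (pow M (u ∘ v) k y)               ≡⟨ pow-slide k y ⟩
      pow M (v ∘ u) k (v y)               ≡⟨ cong (pow M (v ∘ u) k ∘ v) (sym (u-involutive y)) ⟩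
      pow M (v ∘ u) k (v (u (u y)))       ≡⟨ sym (pow-suc (v ∘ u) k (u y)) ⟩
      pow M (v ∘ u) (suc k) (u y)         ∎

    pow-cancel : (∀ y → u (u y) ≡ y) → (∀ y → v (v y) ≡ y) → ∀ k → pow M (u ∘ v) k ∘ pow M (v ∘ u) k ≗ id
    pow-cancel u-involutive v-involutive zero y = refl
    pow-cancel u-involutive v-involutive (suc k) y = begin
      pow M (u ∘ v) (suc k) (v (u (pow M (v ∘ u) k y)))  ≡⟨ pow-suc (u ∘ v) k _ ⟩
      pow M (u ∘ v) k (u (v (v (u (pow M (v ∘ u) k y))))) ≡⟨ cong (pow M (u ∘ v) k) (trans (cong u (v-involutive _)) (u-involutive _)) ⟩
      pow M (u ∘ v) k (pow M (v ∘ u) k y)                 ≡⟨ pow-cancel u-involutive v-involutive k y ⟩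
      y                                                    ∎

  ∣χ : ∀ {t} → t ∣ nV → t ∣ nE → t ∣ nF → t ∣ ∣ χ M ∣
  ∣χ {t} t∣nV t∣nE t∣nF =
    ∣⇒∣ᵤ (∣m∣n⇒∣m+nℤ (∣m∣n⇒∣m-nℤ (∣ᵤ⇒∣ {ℤ.+ t} {ℤ.+ nV} t∣nV) (∣ᵤ⇒∣ {ℤ.+ t} {ℤ.+ nE} t∣nE))
                     (∣ᵤ⇒∣ {ℤ.+ t} {ℤ.+ nF} t∣nF))

  common-divisor-of-cells≡1 : Coprime ∣ χ M ∣ nE → ∀ {t} → t ∣ nV → t ∣ nE → t ∣ nF → t ≡ 1
  common-divisor-of-cells≡1 coprime t∣nV t∣nE t∣nF = coprime (∣χ t∣nV t∣nE t∣nF , t∣nE)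

  record Cells : Set where
    field
      size : ℕ
      cell : Flag → Fin size
      cell-surjective : ∀ w → ∃ λ x → cell x ≡ w
      s₁ s₂ : Flag → Flag
      s₁-involutive : ∀ x → s₁ (s₁ x) ≡ x
      s₂-involutive : ∀ x → s₂ (s₂ x) ≡ x
      sides⊆generators : (s₁ ∷ s₂ ∷ []) ⊆ generators
      cell-spec : ∀ x y → (cell x ≡ cell y) ⇔ Reach (s₁ ∷ s₂ ∷ []) x y

    cell-respects : ∀ {σ} → Commutes σ → ∀ {x y} → cell x ≡ cell y → cell (σ x) ≡ cell (σ y)
    cell-respects σ-comm {x} {y} eq =
      Equivalence.from (cell-spec _ _) (Reach-map (σ-comm ∘ sides⊆generators) (Equivalence.to (cell-spec x y) eq))

  vertices edges faces : Cells
  vertices = record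
    { size = nV ; cell = vtx ; cell-surjective = vtx-surj ; s₁ = r₁ ; s₂ = r₂
    ; s₁-involutive = r₁-inv ; s₂-involutive = r₂-inv ; sides⊆generators = there ; cell-spec = vtx-spec }
  edges = record
    { size = nE ; cell = edge ; cell-surjective = edge-surj ; s₁ = r₀ ; s₂ = r₂
    ; s₁-involutive = r₀-inv ; s₂-involutive = r₂-inv ; sides⊆generators = r₀r₂⊆generators ; cell-spec = edge-spec }
    where
    r₀r₂⊆generators : (r₀ ∷ r₂ ∷ []) ⊆ generators
    r₀r₂⊆generators (here refl) = here refl
    r₀r₂⊆generators (there (here refl)) = there (there (here refl))
  faces = record
    { size = nF ; cell = face ; cell-surjective = face-surj ; s₁ = r₀ ; s₂ = r₁
    ; s₁-involutive = r₀-inv ; s₂-involutive = r₁-inv ; sides⊆generators = r₀r₁⊆generators ; cell-spec = face-spec }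
    where
    r₀r₁⊆generators : (r₀ ∷ r₁ ∷ []) ⊆ generators
    r₀r₁⊆generators (here refl) = here refl
    r₀r₁⊆generators (there (here refl)) = there (here refl)

  module Subgroup (G : AutSubgroup M) where

    infixl 7 _·_
    infix 8 _⁻¹

    n : ℕ
    n = order G

    g : Fin n → Flag → Flag
    g = el G

    commutes : ∀ i → Commutes (g i)
    commutes i = IsAut⇒Commutes (el-aut G i)

    g-injective : ∀ i {u v} → g i u ≡ g i v → u ≡ v
    g-injective i {u} {v} eq with (τ , _ , τ∘gi≗id) , _ ← el-aut G i =
      trans (sym (τ∘gi≗id u)) (trans (cong τ eq) (τ∘gi≗id v))

    ≗⇒≡ : ∀ {i j} → g i ≗ g j → i ≡ j
    ≗⇒≡ {i} {j} = el-inj G i j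

    determined : ∀ {i j x} → g i x ≡ g j x → g i ≗ g j
    determined {i} {j} = Commutes-determined (commutes i) (commutes j)

    fixes-flag⇒≗id : ∀ {i x} → g i x ≡ x → g i ≗ id
    fixes-flag⇒≗id {i} = Commutes-determined (commutes i) CommutesWith-id

    e : Fin n
    e = proj₁ (id-mem G)

    e-id : g e ≗ id
    e-id = proj₂ (id-mem G)

    _·_ : Fin n → Fin n → Fin n
    i · j = proj₁ (comp-mem G i j)

    ·-el : ∀ i j → g (i · j) ≗ g i ∘ g j
    ·-el i j = proj₂ (comp-mem G i j)

    _⁻¹ : Fin n → Fin n
    i ⁻¹ = proj₁ (inv-mem G i)

    ⁻¹-inverseˡ : ∀ i → g (i ⁻¹) ∘ g i ≗ id
    ⁻¹-inverseˡ i = proj₂ (inv-mem G i)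

    ⁻¹-inverseʳ : ∀ i → g i ∘ g (i ⁻¹) ≗ id
    ⁻¹-inverseʳ i y = g-injective (i ⁻¹) (⁻¹-inverseˡ i (g (i ⁻¹) y))

    pow-mem : ∀ i q → ∃ λ j → g j ≗ pow M (g i) q
    pow-mem i zero = e , e-id
    pow-mem i (suc q) with j , gj≗ ← pow-mem i q = i · j , λ y → trans (·-el i j y) (cong (g i) (gj≗ y))

    translation : Fin n → Permutation n n
    translation j = permutation (j ⁻¹ ·_) (j ·_) (cancel (j ⁻¹) j (⁻¹-inverseˡ j)) (cancel j (j ⁻¹) (⁻¹-inverseʳ j))
      where
      cancel : ∀ i j → g i ∘ g j ≗ id → ∀ k → i · (j · k) ≡ k
      cancel i j gigj≗id k = ≗⇒≡ λ y → trans (·-el i (j · k) y) (trans (cong (g i) (·-el j k y)) (gigj≗id (g k y)))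

    module Orbits (C : Cells) where
      open Cells C

      same-cell-translate : ∀ i {u v} → cell u ≡ cell v ⇔ cell (g i u) ≡ cell (g i v)
      same-cell-translate i {u} {v} = mk⇔ (cell-respects (commutes i)) back
        where
        back : cell (g i u) ≡ cell (g i v) → cell u ≡ cell v
        back eq = begin
          cell u                    ≡⟨ cong cell (sym (⁻¹-inverseˡ i u)) ⟩
          cell (g (i ⁻¹) (g i u))   ≡⟨ cell-respects (commutes (i ⁻¹)) eq ⟩
          cell (g (i ⁻¹) (g i v))   ≡⟨ cong cell (⁻¹-inverseˡ i v) ⟩
          cell v                    ∎

      stabilizer : Flag → ℕ
      stabilizer x = length (filter (λ i → cell (g i x) ≟ cell x) (allFin n))

      InOrbit : Flag → Fin size → Set
      InOrbit x w = ∃ λ i → cell (g i x) ≡ w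

      inOrbit? : ∀ x w → Dec (InOrbit x w)
      inOrbit? x w = any? (λ i → cell (g i x) ≟ w)

      orbitSize : Flag → ℕ
      orbitSize x = length (filter (inOrbit? x) (allFin size))

      fibre-size : ∀ x w → length (filter (λ i → cell (g i x) ≟ w) (allFin n)) ≡ indicator (inOrbit? x w) * stabilizer x
      fibre-size x w with inOrbit? x w
      ... | no w∉orbit = cong length (filter-none (λ i → cell (g i x) ≟ w) {allFin n} (All.tabulate λ {i} _ eq → w∉orbit (i , eq)))
      ... | yes (j , gjx∈w) = trans (length-filter-permute _ _ (translation j) moved) (sym (+-identityʳ _))
        where
        moved : ∀ i → cell (g i x) ≡ w ⇔ cell (g (j ⁻¹ · i) x) ≡ cell x
        moved i = mk⇔
          (λ gix∈w → trans (cong cell (·-el (j ⁻¹) i x))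
                      (trans (Equivalence.to (same-cell-translate (j ⁻¹)) (trans gix∈w (sym gjx∈w)))
                             (cong cell (⁻¹-inverseˡ j x))))
          (λ moved-back → trans (Equivalence.from (same-cell-translate (j ⁻¹))
                                  (trans (cong cell (sym (·-el (j ⁻¹) i x)))
                                         (trans moved-back (cong cell (sym (⁻¹-inverseˡ j x))))))
                                gjx∈w)

      orbit-stabilizer : ∀ x → orbitSize x * stabilizer x ≡ n
      orbit-stabilizer x = begin
        orbitSize x * stabilizer x
          ≡⟨ cong (_* stabilizer x) (length-filter-tabulate (inOrbit? x) id) ⟩
        sum (indicator ∘ inOrbit? x) * stabilizer x
          ≡⟨ *-distribʳ-sum (stabilizer x) (indicator ∘ inOrbit? x) ⟩
        sum (λ w → indicator (inOrbit? x w) * stabilizer x)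
          ≡⟨ sum-cong-≗ (λ w → sym (fibre-size x w)) ⟩
        sum (λ w → length (filter (λ i → cell (g i x) ≟ w) (allFin n)))
          ≡⟨ ∑-length-fibres (λ i → cell (g i x)) (allFin n) ⟩
        length (allFin n)
          ≡⟨ length-tabulate id ⟩
        n ∎

      stabilizer∣order : ∀ x → stabilizer x ∣ n
      stabilizer∣order x = divides (orbitSize x) (sym (orbit-stabilizer x))

      orbitSize∣order : ∀ x → orbitSize x ∣ n
      orbitSize∣order x = divides (stabilizer x) (trans (sym (orbit-stabilizer x)) (*-comm (orbitSize x) _))

      stabilizer-nonZero : ∀ x → NonZero (stabilizer x)
      stabilizer-nonZero x = >-nonZero (filter-some (λ i → cell (g i x) ≟ cell x) (lose (∈-allFin e) (cong cell (e-id x))))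

      orbitSize≡1⇒fixed : ∀ {x} → orbitSize x ≡ 1 → ∀ i → cell (g i x) ≡ cell x
      orbitSize≡1⇒fixed {x} orbit≡1 i =
        proj₂ (∈-filter⁻ stabilizes? {xs = allFin n} (subst (i ∈_) (sym (filter-complete stabilizes? everything)) (∈-allFin i)))
        where
        stabilizes? : Decidable (λ i → cell (g i x) ≡ cell x)
        stabilizes? i = cell (g i x) ≟ cell x
        everything : stabilizer x ≡ length (allFin n)
        everything = begin
          stabilizer x                  ≡⟨ sym (+-identityʳ (stabilizer x)) ⟩
          1 * stabilizer x              ≡⟨ cong (_* stabilizer x) (sym orbit≡1) ⟩
          orbitSize x * stabilizer x    ≡⟨ orbit-stabilizer x ⟩
          n                             ≡⟨ sym (length-tabulate id) ⟩
          length (allFin n)             ∎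

      representative : Fin size → Flag
      representative w = proj₁ (cell-surjective w)

      SameOrbit : Rel (Fin size) 0ℓ
      SameOrbit w = InOrbit (representative w)

      sameOrbit-isEquivalence : IsEquivalence SameOrbit
      sameOrbit-isEquivalence = record { refl = reflexive ; sym = symmetric ; trans = transitive }
        where
        rep-cell : ∀ w → cell (representative w) ≡ w
        rep-cell w = proj₂ (cell-surjective w)
        reflexive : ∀ {w} → SameOrbit w w
        reflexive {w} = e , trans (cong cell (e-id _)) (rep-cell w)
        symmetric : ∀ {w w′} → SameOrbit w w′ → SameOrbit w′ w
        symmetric {w} {w′} (i , gi∈w′) = i ⁻¹ , (begin
          cell (g (i ⁻¹) (representative w′))
            ≡⟨ cell-respects (commutes (i ⁻¹)) (trans (rep-cell w′) (sym gi∈w′)) ⟩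
          cell (g (i ⁻¹) (g i (representative w)))
            ≡⟨ cong cell (⁻¹-inverseˡ i _) ⟩
          cell (representative w)
            ≡⟨ rep-cell w ⟩
          w ∎)
        transitive : ∀ {w w′ w″} → SameOrbit w w′ → SameOrbit w′ w″ → SameOrbit w w″
        transitive {w} {w′} (i , gi∈w′) (j , gj∈w″) = j · i , (begin
          cell (g (j · i) (representative w))  ≡⟨ cong cell (·-el j i _) ⟩
          cell (g j (g i (representative w)))  ≡⟨ cell-respects (commutes j) (trans gi∈w′ (sym (rep-cell w′))) ⟩
          cell (g j (representative w′))       ≡⟨ gj∈w″ ⟩
          _ ∎)

      orbits-additive : (Q : ℕ → Set) → Q 0 → (∀ {k l} → Q k → Q l → Q (k + l)) → (∀ x → Q (orbitSize x)) → Q size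
      orbits-additive Q Q-zero Q-+ Q-orbit =
        subst Q (length-tabulate id)
          (additive-over-classes (inOrbit? ∘ representative) sameOrbit-isEquivalence Q Q-zero Q-+ (allFin size)
                                 (λ {w} _ → Q-orbit (representative w)))

  module _ (G : AutSubgroup M) where
    open Subgroup G

    stabilizersAt : Flag → List ℕ
    stabilizersAt x = stabV M G x ∷ stabE M G x ∷ stabF M G x ∷ []

    stabilizer∣lcmStab : ∀ x {k} → k ∈ stabilizersAt x → k ∣ lcmStab M G
    stabilizer∣lcmStab x k∈ = ∈⇒∣foldr-lcm (∈-concatMap⁺ stabilizersAt (lose (∈-allFin x) k∈))

    lcmStab∣order : lcmStab M G ∣ n
    lcmStab∣order =
      foldr-lcm-least (λ k∈ → stabilizers∣order (proj₂ (satisfied (∈-concatMap⁻ stabilizersAt {xs = allFin nFlags} k∈))))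
      where
      stabilizers∣order : ∀ {x k} → k ∈ stabilizersAt x → k ∣ n
      stabilizers∣order {x} (here refl) = Orbits.stabilizer∣order vertices x
      stabilizers∣order {x} (there (here refl)) = Orbits.stabilizer∣order edges x
      stabilizers∣order {x} (there (there (here refl))) = Orbits.stabilizer∣order faces x

    order≡lcmStab : Coprime ∣ χ M ∣ nE → n ≡ lcmStab M G
    order≡lcmStab coprime with lcmStab∣order
    ... | divides t n≡t*L = trans n≡t*L (trans (cong (_* lcmStab M G) t≡1) (*-identityˡ _))
      where
      t∣size : ∀ C → (∀ x → Orbits.stabilizer C x ∣ lcmStab M G) → t ∣ Cells.size C
      t∣size C stabilizer∣L = Orbits.orbits-additive C (t ∣_) (t ∣0) ∣m∣n⇒∣m+n (λ x →
        quotient-∣ {{Orbits.stabilizer-nonZero C x}} (trans (Orbits.orbit-stabilizer C x) n≡t*L) (stabilizer∣L x))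
      t≡1 : t ≡ 1
      t≡1 = common-divisor-of-cells≡1 coprime
        (t∣size vertices (λ x → stabilizer∣lcmStab x (here refl)))
        (t∣size edges (λ x → stabilizer∣lcmStab x (there (here refl))))
        (t∣size faces (λ x → stabilizer∣lcmStab x (there (there (here refl)))))

  edge-flags : Flag → List Flag
  edge-flags x = x ∷ r₀ x ∷ r₂ x ∷ r₀ (r₂ x) ∷ []

  edge-flags-unique : ∀ x → Unique (edge-flags x)
  edge-flags-unique x =
    (x≢r₀x ∷ x≢r₂x ∷ x≢r₀r₂x ∷ []) ∷ (r₀x≢r₂x ∷ r₀x≢r₀r₂x ∷ []) ∷ (r₂x≢r₀r₂x ∷ []) ∷ [] ∷ []
    where
    x≢r₀x : x ≢ r₀ x
    x≢r₀x = r₀-fpf x ∘ sym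
    x≢r₂x : x ≢ r₂ x
    x≢r₂x = r₂-fpf x ∘ sym
    x≢r₀r₂x : x ≢ r₀ (r₂ x)
    x≢r₀r₂x = r₀r₂-fpf x ∘ sym
    r₀x≢r₂x : r₀ x ≢ r₂ x
    r₀x≢r₂x eq = r₀r₂-fpf x (trans (cong r₀ (sym eq)) (r₀-inv x))
    r₀x≢r₀r₂x : r₀ x ≢ r₀ (r₂ x)
    r₀x≢r₀r₂x eq = x≢r₂x (trans (sym (r₀-inv x)) (trans (cong r₀ eq) (r₀-inv (r₂ x))))
    r₂x≢r₀r₂x : r₂ x ≢ r₀ (r₂ x)
    r₂x≢r₀r₂x eq = r₀-fpf (r₂ x) (sym eq)

  edge-flags-r₀ : ∀ {x y} → y ∈ edge-flags x → r₀ y ∈ edge-flags x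
  edge-flags-r₀ (here refl) = there (here refl)
  edge-flags-r₀ (there (here refl)) = here (r₀-inv _)
  edge-flags-r₀ (there (there (here refl))) = there (there (there (here refl)))
  edge-flags-r₀ {x} (there (there (there (here refl)))) = there (there (here (r₀-inv (r₂ x))))

  edge-flags-r₂ : ∀ {x y} → y ∈ edge-flags x → r₂ y ∈ edge-flags x
  edge-flags-r₂ (here refl) = there (there (here refl))
  edge-flags-r₂ {x} (there (here refl)) = there (there (there (here (sym (r₀r₂-comm x)))))
  edge-flags-r₂ (there (there (here refl))) = here (r₂-inv _)
  edge-flags-r₂ {x} (there (there (there (here refl)))) = there (here (trans (cong r₂ (r₀r₂-comm x)) (r₂-inv (r₀ x))))

  same-edge⇔∈edge-flags : ∀ x y → edge y ≡ edge x ⇔ y ∈ edge-flags x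
  same-edge⇔∈edge-flags x y =
    mk⇔ (λ eq → closed (Equivalence.to (edge-spec x y) (sym eq)) (here refl))
        (λ y∈ → sym (Equivalence.from (edge-spec x y) (path y∈)))
    where
    closed : ∀ {z w} → Reach (r₀ ∷ r₂ ∷ []) z w → z ∈ edge-flags x → w ∈ edge-flags x
    closed here z∈ = z∈
    closed (step (here refl) r) z∈ = closed r (edge-flags-r₀ z∈)
    closed (step (there (here refl)) r) z∈ = closed r (edge-flags-r₂ z∈)
    path : ∀ {y} → y ∈ edge-flags x → Reach (r₀ ∷ r₂ ∷ []) x y
    path (here refl) = here
    path (there (here refl)) = step (here refl) here
    path (there (there (here refl))) = step (there (here refl)) here
    path (there (there (there (here refl)))) = step (there (here refl)) (step (here refl) here)

  module _ (G : AutSubgroup M) where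
    open Subgroup G
    open Orbits edges

    Sends : Flag → Flag → Set
    Sends x y = ∃ λ i → g i x ≡ y

    sends? : ∀ x y → Dec (Sends x y)
    sends? x y = any? (λ i → g i x ≟ y)

    length-filter-sends : ∀ x y → length (filter (λ i → g i x ≟ y) (allFin n)) ≡ indicator (sends? x y)
    length-filter-sends x y with sends? x y
    ... | no ¬sends = cong length (filter-none (λ i → g i x ≟ y) {allFin n} (All.tabulate λ {i} _ eq → ¬sends (i , eq)))
    ... | yes (j , gjx≡y) = begin
      length (filter (λ i → g i x ≟ y) (allFin n))
        ≡⟨ cong length (filter-≐ (λ i → g i x ≟ y) (j ≟_) (only-j , λ { refl → gjx≡y }) (allFin n)) ⟩
      length (filter (j ≟_) (allFin n))             ≡⟨ length-filter-tabulate (j ≟_) id ⟩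
      sum (λ i → indicator (j ≟ i))                 ≡⟨ ∑-indicator-≟ j ⟩
      1                                             ∎
      where
      only-j : ∀ {i} → g i x ≡ y → j ≡ i
      only-j gix≡y = ≗⇒≡ (determined (trans gjx≡y (sym gix≡y)))

    edge-stabilizer : ∀ x →
      stabilizer x ≡ 1 + (indicator (sends? x (r₀ x)) + (indicator (sends? x (r₂ x)) + (indicator (sends? x (r₀ (r₂ x))) + 0)))
    edge-stabilizer x =
      trans (cong length (filter-≐ _ _ same-edge≐∈edge-flags (allFin n)))
        (trans (length-filter-∈ (λ i → g i x) (edge-flags-unique x) (allFin n))
          (cong₂ _+_ (trans (length-filter-sends x x) (indicator-yes (sends? x x) (e , e-id x)))
            (cong₂ _+_ (length-filter-sends x (r₀ x))
              (cong₂ _+_ (length-filter-sends x (r₂ x)) (cong (_+ 0) (length-filter-sends x (r₀ (r₂ x))))))))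
      where
      same-edge≐∈edge-flags : (λ i → edge (g i x) ≡ edge x) ≐ (λ i → g i x ∈ edge-flags x)
      same-edge≐∈edge-flags = Equivalence.to (same-edge⇔∈edge-flags x _) , Equivalence.from (same-edge⇔∈edge-flags x _)

    sends-∘ : ∀ x (u v : Flag → Flag) → Sends x (u x) → Sends x (v x) → (∀ i → g i ∘ v ≗ v ∘ g i) → Sends x (v (u x))
    sends-∘ x u v (i , gix) (j , gjx) v-commutes = i · j , (begin
      g (i · j) x   ≡⟨ ·-el i j x ⟩
      g i (g j x)   ≡⟨ cong (g i) gjx ⟩
      g i (v x)     ≡⟨ v-commutes i x ⟩
      v (g i x)     ≡⟨ cong v gix ⟩
      v (u x)       ∎)

    edge-stabilizer∣4 : ∀ x → stabilizer x ∣ 4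
    edge-stabilizer∣4 x =
      subst (_∣ 4) (sym (edge-stabilizer x)) (klein (sends? x (r₀ x)) (sends? x (r₂ x)) (sends? x (r₀ (r₂ x))))
      where
      r₀-commutes : ∀ i → g i ∘ r₀ ≗ r₀ ∘ g i
      r₀-commutes i = commutes i (here refl)
      r₂-commutes : ∀ i → g i ∘ r₂ ≗ r₂ ∘ g i
      r₂-commutes i = commutes i (there (there (here refl)))
      r₀r₂-commutes : ∀ i → g i ∘ r₀ ∘ r₂ ≗ (r₀ ∘ r₂) ∘ g i
      r₀r₂-commutes i y = trans (r₀-commutes i (r₂ y)) (cong r₀ (r₂-commutes i y))
      klein : (d₀ : Dec (Sends x (r₀ x))) (d₂ : Dec (Sends x (r₂ x))) (d₀₂ : Dec (Sends x (r₀ (r₂ x)))) →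
              1 + (indicator d₀ + (indicator d₂ + (indicator d₀₂ + 0))) ∣ 4
      klein (yes _) (yes _) (yes _) = divides 1 refl
      klein (yes s₀) (yes s₂) (no ¬s₀₂) =
        contradiction (subst (Sends x) (sym (r₀r₂-comm x)) (sends-∘ x r₀ r₂ s₀ s₂ r₂-commutes)) ¬s₀₂
      klein (yes s₀) (no ¬s₂) (yes s₀₂) =
        contradiction (subst (Sends x) (trans (cong r₀ (sym (r₀r₂-comm x))) (r₀-inv (r₂ x)))
                             (sends-∘ x r₀ (r₀ ∘ r₂) s₀ s₀₂ r₀r₂-commutes)) ¬s₂
      klein (no ¬s₀) (yes s₂) (yes s₀₂) =
        contradiction (subst (Sends x) (cong r₀ (r₂-inv x)) (sends-∘ x r₂ (r₀ ∘ r₂) s₂ s₀₂ r₀r₂-commutes)) ¬s₀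
      klein (yes _) (no _) (no _) = divides 2 refl
      klein (no _) (yes _) (no _) = divides 2 refl
      klein (no _) (no _) (yes _) = divides 2 refl
      klein (no _) (no _) (no _) = divides 4 refl

    gcd-χ-order∣4 : Coprime ∣ χ M ∣ nE → gcd (∣ χ M ∣) n ∣ 4
    gcd-χ-order∣4 coprime =
      coprime-divisor d-coprime-nE (orbits-additive (λ k → d ∣ k * 4) (d ∣0) (λ {k} {l} → additive {k} {l}) d∣orbit*4)
      where
      d : ℕ
      d = gcd (∣ χ M ∣) n
      d-coprime-nE : Coprime d nE
      d-coprime-nE (k∣d , k∣nE) = coprime (∣-trans k∣d (gcd[m,n]∣m (∣ χ M ∣) n) , k∣nE)
      additive : ∀ {k l} → d ∣ k * 4 → d ∣ l * 4 → d ∣ (k + l) * 4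
      additive {k} {l} d∣k*4 d∣l*4 = subst (d ∣_) (sym (*-distribʳ-+ 4 k l)) (∣m∣n⇒∣m+n d∣k*4 d∣l*4)
      d∣orbit*4 : ∀ x → d ∣ orbitSize x * 4
      d∣orbit*4 x = ∣-trans (gcd[m,n]∣n (∣ χ M ∣) n)
        (subst (_∣ orbitSize x * 4) (orbit-stabilizer x) (*-monoʳ-∣ (orbitSize x) (edge-stabilizer∣4 x)))

    gcd-χ-order≢1⇒nE-odd : Coprime ∣ χ M ∣ nE → gcd (∣ χ M ∣) n ≢ 1 → ¬ 2 ∣ nE
    gcd-χ-order≢1⇒nE-odd coprime d≢1 2∣nE with prime-power-divisor prime[2] 2 (gcd-χ-order∣4 coprime)
    ... | inj₁ d≡1 = d≢1 d≡1
    ... | inj₂ 2∣d = contradiction (coprime (∣-trans 2∣d (gcd[m,n]∣m (∣ χ M ∣) n) , 2∣nE)) λ ()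

  module CellStabilizer (H : AutSubgroup M) (C : Cells) (x : Flag)
                        (fixes-cell : ∀ i → Cells.cell C (el H i x) ≡ Cells.cell C x) where
    open Subgroup H
    open Cells C using (cell-spec; sides⊆generators)
      renaming (s₁ to a; s₂ to b; s₁-involutive to a-involutive; s₂-involutive to b-involutive)

    a-commutes : ∀ i → g i ∘ a ≗ a ∘ g i
    a-commutes i = commutes i (sides⊆generators (here refl))

    b-commutes : ∀ i → g i ∘ b ≗ b ∘ g i
    b-commutes i = commutes i (sides⊆generators (there (here refl)))

    orbit⊆cell : ∀ i → Reach (a ∷ b ∷ []) x (g i x)
    orbit⊆cell i = Equivalence.to (cell-spec x (g i x)) (sym (fixes-cell i))

    walk : ℕ → Flag → Flag
    walk = pow M (a ∘ b)

    walk-commutes : ∀ i k → g i ∘ walk k ≗ walk k ∘ g i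
    walk-commutes i = pow-commute (a ∘ b) (g i) (λ y → trans (a-commutes i (b y)) (cong a (b-commutes i y)))

    ab-injective : ∀ {u v} → a (b u) ≡ a (b v) → u ≡ v
    ab-injective {u} {v} eq = begin
      u         ≡⟨ sym (b-involutive u) ⟩
      b (b u)   ≡⟨ cong b (trans (sym (a-involutive (b u))) (trans (cong a eq) (a-involutive (b v)))) ⟩
      b (b v)   ≡⟨ b-involutive v ⟩
      v         ∎

    opaque
      walk-cycle : ∃ λ l → walk (suc l) x ≡ x
      walk-cycle with i , j , i<j , walk-i≡walk-j ← pigeonhole (n<1+n nFlags) (λ (k : Fin (suc nFlags)) → walk (toℕ k) x) =
        positive (m<n⇒0<n∸m i<j) returns
        where
        returns : walk (toℕ j ∸ toℕ i) x ≡ x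
        returns = pow-injective (a ∘ b) ab-injective (toℕ i) (begin
          walk (toℕ i) (walk (toℕ j ∸ toℕ i) x)  ≡⟨ sym (pow-+ (a ∘ b) (toℕ i) _ x) ⟩
          walk (toℕ i + (toℕ j ∸ toℕ i)) x       ≡⟨ cong (λ k → walk k x) (m+[n∸m]≡n (<⇒≤ i<j)) ⟩
          walk (toℕ j) x                         ≡⟨ sym walk-i≡walk-j ⟩
          walk (toℕ i) x                         ∎)
        positive : ∀ {d} → 0 < d → walk d x ≡ x → ∃ λ l → walk (suc l) x ≡ x
        positive {suc d} _ walk-d = d , walk-d

    -- On the cycle through x, walking back one step is walking forward `back` steps.
    back : ℕ
    back = proj₁ walk-cycle

    OnCycle : Flag → Set
    OnCycle z = walk (suc back) z ≡ z

    x-on-cycle : OnCycle x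
    x-on-cycle = proj₂ walk-cycle

    ax-on-cycle : OnCycle (a x)
    ax-on-cycle = begin
      walk (suc back) (a x)                             ≡⟨ cong (walk (suc back) ∘ a) (sym x-on-cycle) ⟩
      walk (suc back) (a (walk (suc back) x))           ≡⟨ cong (walk (suc back)) (pow-reflect a b a-involutive (suc back) x) ⟩
      walk (suc back) (pow M (b ∘ a) (suc back) (a x))  ≡⟨ pow-cancel a b a-involutive b-involutive (suc back) (a x) ⟩
      a x                                               ∎

    walk-back : ∀ {z} → OnCycle z → ∀ k → pow M (b ∘ a) k z ≡ walk (k * back) z
    walk-back {z} on-cycle k = pow-injective (a ∘ b) ab-injective k (begin
      walk k (pow M (b ∘ a) k z)   ≡⟨ pow-cancel a b a-involutive b-involutive k z ⟩
      z                            ≡⟨ sym (pow-*-fixed (a ∘ b) (suc back) on-cycle k) ⟩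
      walk (k * suc back) z        ≡⟨ cong (λ l → walk l z) (*-suc k back) ⟩
      walk (k + k * back) z        ≡⟨ pow-+ (a ∘ b) k (k * back) z ⟩
      walk k (walk (k * back) z)   ∎)

    mirror-x : ∀ k → a (walk k x) ≡ walk (k * back) (a x)
    mirror-x k = trans (pow-reflect a b a-involutive k x) (walk-back ax-on-cycle k)

    mirror-ax : ∀ k → a (walk k (a x)) ≡ walk (k * back) x
    mirror-ax k = trans (pow-reflect a b a-involutive k (a x)) (trans (cong (pow M (b ∘ a) k) (a-involutive x)) (walk-back x-on-cycle k))

    Position : Flag → Set
    Position z = (∃ λ k → z ≡ walk k x) ⊎ (∃ λ k → z ≡ walk k (a x))

    position-a : ∀ {z} → Position z → Position (a z)
    position-a (inj₁ (k , refl)) = inj₂ (k * back , mirror-x k)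
    position-a (inj₂ (k , refl)) = inj₁ (k * back , mirror-ax k)

    position-b : ∀ {z} → Position z → Position (b z)
    position-b {z} p = subst Position (a-involutive (b z)) (position-a (advance p))
      where
      advance : Position z → Position (a (b z))
      advance (inj₁ (k , refl)) = inj₁ (suc k , refl)
      advance (inj₂ (k , refl)) = inj₂ (suc k , refl)

    position-Reach : ∀ {z y} → Reach (a ∷ b ∷ []) z y → Position z → Position y
    position-Reach here p = p
    position-Reach (step (here refl) r) p = position-Reach r (position-a p)
    position-Reach (step (there (here refl)) r) p = position-Reach r (position-b p)

    position : ∀ i → Position (g i x)
    position i = position-Reach (orbit⊆cell i) (inj₁ (0 , refl))

    Rotates : ℕ → Set
    Rotates k = 0 < k × ∃ λ i → g i x ≡ walk k x

    rotates? : ∀ k → Dec (Rotates k)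
    rotates? k = (0 <? k) ×-dec any? (λ i → g i x ≟ walk k x)

    opaque
      least-rotation : ∃ λ k → Rotates k × (∀ {j} → j < k → ¬ Rotates j)
      least-rotation = least-witness rotates? (suc back) (s≤s z≤n , e , trans (e-id x) (sym x-on-cycle))

    k₀ : ℕ
    k₀ = proj₁ least-rotation

    instance
      k₀-nonZero : NonZero k₀
      k₀-nonZero = >-nonZero (proj₁ (proj₁ (proj₂ least-rotation)))

    ρ : Fin n
    ρ = proj₁ (proj₂ (proj₁ (proj₂ least-rotation)))

    ρ-rotates : g ρ x ≡ walk k₀ x
    ρ-rotates = proj₂ (proj₂ (proj₁ (proj₂ least-rotation)))

    ρ^ : ℕ → Flag → Flag
    ρ^ = pow M (g ρ)

    ρ^-position : ∀ q → ρ^ q x ≡ walk (q * k₀) x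
    ρ^-position zero = refl
    ρ^-position (suc q) = begin
      g ρ (ρ^ q x)               ≡⟨ cong (g ρ) (ρ^-position q) ⟩
      g ρ (walk (q * k₀) x)      ≡⟨ walk-commutes ρ (q * k₀) x ⟩
      walk (q * k₀) (g ρ x)      ≡⟨ cong (walk (q * k₀)) ρ-rotates ⟩
      walk (q * k₀) (walk k₀ x)  ≡⟨ sym (pow-+ (a ∘ b) (q * k₀) k₀ x) ⟩
      walk (q * k₀ + k₀) x       ≡⟨ cong (λ l → walk l x) (+-comm (q * k₀) k₀) ⟩
      walk (k₀ + q * k₀) x       ∎

    short-rotation-trivial : ∀ {i r} → r < k₀ → g i x ≡ walk r x → g i ≗ id
    short-rotation-trivial {i} {zero} _ gix≡x = fixes-flag⇒≗id gix≡x
    short-rotation-trivial {i} {suc r} r<k₀ gix = contradiction (s≤s z≤n , i , gix) (proj₂ (proj₂ least-rotation) r<k₀)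

    rotation⇒power : ∀ {i} k → g i x ≡ walk k x → g i ≗ ρ^ (k / k₀)
    rotation⇒power {i} k gix y = begin
      g i y                     ≡⟨ sym (⁻¹-inverseʳ j (g i y)) ⟩
      g j (g (j ⁻¹) (g i y))    ≡⟨ cong (g j) (trans (sym (·-el (j ⁻¹) i y)) (quotient-trivial y)) ⟩
      g j y                     ≡⟨ gj≗ρ^q y ⟩
      ρ^ (k / k₀) y             ∎
      where
      j : Fin n
      j = proj₁ (pow-mem ρ (k / k₀))
      gj≗ρ^q : g j ≗ ρ^ (k / k₀)
      gj≗ρ^q = proj₂ (pow-mem ρ (k / k₀))
      j⁻¹-returns : walk ((k / k₀) * k₀) (g (j ⁻¹) x) ≡ x
      j⁻¹-returns = begin
        walk ((k / k₀) * k₀) (g (j ⁻¹) x)  ≡⟨ sym (walk-commutes (j ⁻¹) ((k / k₀) * k₀) x) ⟩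
        g (j ⁻¹) (walk ((k / k₀) * k₀) x)  ≡⟨ cong (g (j ⁻¹)) (sym (trans (gj≗ρ^q x) (ρ^-position (k / k₀)))) ⟩
        g (j ⁻¹) (g j x)                   ≡⟨ ⁻¹-inverseˡ j x ⟩
        x                                  ∎
      quotient-position : g (j ⁻¹ · i) x ≡ walk (k % k₀) x
      quotient-position = begin
        g (j ⁻¹ · i) x                                          ≡⟨ ·-el (j ⁻¹) i x ⟩
        g (j ⁻¹) (g i x)                                        ≡⟨ cong (g (j ⁻¹)) gix ⟩
        g (j ⁻¹) (walk k x)                                     ≡⟨ walk-commutes (j ⁻¹) k x ⟩
        walk k (g (j ⁻¹) x)                                     ≡⟨ cong (λ l → walk l (g (j ⁻¹) x)) (m≡m%n+[m/n]*n k k₀) ⟩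
        walk (k % k₀ + (k / k₀) * k₀) (g (j ⁻¹) x)              ≡⟨ pow-+ (a ∘ b) (k % k₀) _ _ ⟩
        walk (k % k₀) (walk ((k / k₀) * k₀) (g (j ⁻¹) x))       ≡⟨ cong (walk (k % k₀)) j⁻¹-returns ⟩
        walk (k % k₀) x                                         ∎
      quotient-trivial : g (j ⁻¹ · i) ≗ id
      quotient-trivial = short-rotation-trivial (m%n<n k k₀) quotient-position

    Periodic : ℕ → Set
    Periodic o = 0 < o × ρ^ o ≗ id

    periodic? : ∀ o → Dec (Periodic o)
    periodic? o = (0 <? o) ×-dec all? (λ y → ρ^ o y ≟ y)

    opaque
      ρ-order : ∃ λ o → Periodic o × (∀ {j} → j < o → ¬ Periodic j)
      ρ-order = least-witness periodic? (suc back) (s≤s z≤n , ρ^-cycle)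
        where
        ρ^-cycle : ρ^ (suc back) ≗ id
        ρ^-cycle = Commutes-determined (CommutesWith-pow (commutes ρ) (suc back)) CommutesWith-id (begin
          ρ^ (suc back) x             ≡⟨ ρ^-position (suc back) ⟩
          walk (suc back * k₀) x      ≡⟨ cong (λ l → walk l x) (*-comm (suc back) k₀) ⟩
          walk (k₀ * suc back) x      ≡⟨ pow-*-fixed (a ∘ b) (suc back) x-on-cycle k₀ ⟩
          x                           ∎)

    o : ℕ
    o = proj₁ ρ-order

    instance
      o-nonZero : NonZero o
      o-nonZero = >-nonZero (proj₁ (proj₁ (proj₂ ρ-order)))

    ρ^o : ρ^ o ≗ id
    ρ^o = proj₂ (proj₁ (proj₂ ρ-order))

    difference-periodic : ∀ {i j} → i < j → ρ^ i ≗ ρ^ j → Periodic (j ∸ i)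
    difference-periodic {i} {j} i<j eq = m<n⇒0<n∸m i<j ,
      Commutes-determined (CommutesWith-pow (commutes ρ) (j ∸ i)) CommutesWith-id (begin
        ρ^ (j ∸ i) (ρ^ i x)   ≡⟨ sym (pow-+ (g ρ) (j ∸ i) i x) ⟩
        ρ^ (j ∸ i + i) x      ≡⟨ cong (λ l → ρ^ l x) (m∸n+n≡m (<⇒≤ i<j)) ⟩
        ρ^ j x                ≡⟨ sym (eq x) ⟩
        ρ^ i x                ∎)

    ρ^-injective : ∀ {r r′} → r < o → r′ < o → ρ^ r ≗ ρ^ r′ → r ≡ r′
    ρ^-injective {r} {r′} r<o r′<o eq with <-cmp r r′
    ... | tri< r<r′ _ _ = contradiction (difference-periodic r<r′ eq) (proj₂ (proj₂ ρ-order) (≤-<-trans (m∸n≤m r′ r) r′<o))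
    ... | tri≈ _ r≡r′ _ = r≡r′
    ... | tri> _ _ r′<r = contradiction (difference-periodic r′<r (sym ∘ eq)) (proj₂ (proj₂ ρ-order) (≤-<-trans (m∸n≤m r r′) r<o))

    reduce : ℕ → Fin o
    reduce q = fromℕ< (m%n<n q o)

    ρ^-reduce : ∀ q → ρ^ q ≗ ρ^ (toℕ (reduce q))
    ρ^-reduce q y = trans (pow-% (g ρ) o (ρ^o y) q) (cong (λ l → ρ^ l y) (sym (toℕ-fromℕ< (m%n<n q o))))

    IsRotation : Fin n → Set
    IsRotation i = ∃ λ (r : Fin o) → g i ≗ ρ^ (toℕ r)

    rotation? : ∀ i → Dec (IsRotation i)
    rotation? i = any? (λ r → all? (λ y → g i y ≟ ρ^ (toℕ r) y))

    rotation-position⇒IsRotation : ∀ {i} k → g i x ≡ walk k x → IsRotation i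
    rotation-position⇒IsRotation k gix = reduce (k / k₀) , λ y → trans (rotation⇒power k gix y) (ρ^-reduce (k / k₀) y)

    reflection-involutive : ∀ {i} k → g i x ≡ walk k (a x) → g i ∘ g i ≗ id
    reflection-involutive {i} k gix = Commutes-determined (CommutesWith-∘ (commutes i) (commutes i)) CommutesWith-id (begin
      g i (g i x)                        ≡⟨ cong (g i) gix ⟩
      g i (walk k (a x))                 ≡⟨ walk-commutes i k (a x) ⟩
      walk k (g i (a x))                 ≡⟨ cong (walk k) (trans (a-commutes i x) (cong a gix)) ⟩
      walk k (a (walk k (a x)))          ≡⟨ cong (walk k) (pow-reflect a b a-involutive k (a x)) ⟩
      walk k (pow M (b ∘ a) k (a (a x))) ≡⟨ cong (walk k ∘ pow M (b ∘ a) k) (a-involutive x) ⟩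
      walk k (pow M (b ∘ a) k x)         ≡⟨ pow-cancel a b a-involutive b-involutive k x ⟩
      x                                  ∎)

    module Reflection (t : Fin n) (t-not-rotation : ¬ IsRotation t) (s : ℕ) (t-position : g t x ≡ walk s (a x)) where

      t-involutive : g t ∘ g t ≗ id
      t-involutive = reflection-involutive s t-position

      tρ-involutive : g t ∘ g ρ ∘ g t ∘ g ρ ≗ id
      tρ-involutive y =
        trans (sym (trans (·-el t ρ _) (cong (g t ∘ g ρ) (·-el t ρ y)))) (reflection-involutive (k₀ + s) tρ-position y)
        where
        tρ-position : g (t · ρ) x ≡ walk (k₀ + s) (a x)
        tρ-position = begin
          g (t · ρ) x             ≡⟨ ·-el t ρ x ⟩
          g t (g ρ x)             ≡⟨ cong (g t) ρ-rotates ⟩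
          g t (walk k₀ x)         ≡⟨ walk-commutes t k₀ x ⟩
          walk k₀ (g t x)         ≡⟨ cong (walk k₀) t-position ⟩
          walk k₀ (walk s (a x))  ≡⟨ sym (pow-+ (a ∘ b) k₀ s (a x)) ⟩
          walk (k₀ + s) (a x)     ∎

      reflection⇒rotation∘t : ∀ {j} k → g j x ≡ walk k (a x) → g j ≗ ρ^ ((s + k * back) / k₀) ∘ g t
      reflection⇒rotation∘t {j} k gjx y = begin
        g j y                              ≡⟨ cong (g j) (sym (t-involutive y)) ⟩
        g j (g t (g t y))                  ≡⟨ sym (·-el j t (g t y)) ⟩
        g (j · t) (g t y)                  ≡⟨ rotation⇒power (s + k * back) jt-position (g t y) ⟩
        ρ^ ((s + k * back) / k₀) (g t y)   ∎
        where
        jt-position : g (j · t) x ≡ walk (s + k * back) x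
        jt-position = begin
          g (j · t) x                 ≡⟨ ·-el j t x ⟩
          g j (g t x)                 ≡⟨ cong (g j) t-position ⟩
          g j (walk s (a x))          ≡⟨ walk-commutes j s (a x) ⟩
          walk s (g j (a x))          ≡⟨ cong (walk s) (trans (a-commutes j x) (cong a gjx)) ⟩
          walk s (a (walk k (a x)))   ≡⟨ cong (walk s) (mirror-ax k) ⟩
          walk s (walk (k * back) x)  ≡⟨ sym (pow-+ (a ∘ b) s (k * back) x) ⟩
          walk (s + k * back) x       ∎

      rotation-or-reflection : ∀ j → ∃ λ q → g j ≗ ρ^ q ⊎ g j ≗ ρ^ q ∘ g t
      rotation-or-reflection j with position j
      ... | inj₁ (k , gjx) = k / k₀ , inj₁ (rotation⇒power k gjx)
      ... | inj₂ (k , gjx) = (s + k * back) / k₀ , inj₂ (reflection⇒rotation∘t k gjx)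

      rotation≉reflection : ∀ {r r′} → r′ < o → ¬ (ρ^ r ≗ ρ^ r′ ∘ g t)
      rotation≉reflection {r} {r′} r′<o eq = t-not-rotation (reduce (o ∸ r′ + r) , λ y → begin
        g t y                        ≡⟨ sym (ρ^o (g t y)) ⟩
        ρ^ o (g t y)                 ≡⟨ cong (λ l → ρ^ l (g t y)) (sym (m∸n+n≡m (<⇒≤ r′<o))) ⟩
        ρ^ (o ∸ r′ + r′) (g t y)     ≡⟨ pow-+ (g ρ) (o ∸ r′) r′ (g t y) ⟩
        ρ^ (o ∸ r′) (ρ^ r′ (g t y))  ≡⟨ cong (ρ^ (o ∸ r′)) (sym (eq y)) ⟩
        ρ^ (o ∸ r′) (ρ^ r y)         ≡⟨ sym (pow-+ (g ρ) (o ∸ r′) r y) ⟩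
        ρ^ (o ∸ r′ + r) y            ≡⟨ ρ^-reduce (o ∸ r′ + r) y ⟩
        ρ^ (toℕ (reduce (o ∸ r′ + r))) y ∎)

      element : Fin o ⊎ Fin o → Fin n
      element (inj₁ r) = proj₁ (pow-mem ρ (toℕ r))
      element (inj₂ r) = proj₁ (pow-mem ρ (toℕ r)) · t

      element-rotation : ∀ r → g (element (inj₁ r)) ≗ ρ^ (toℕ r)
      element-rotation r = proj₂ (pow-mem ρ (toℕ r))

      element-reflection : ∀ r → g (element (inj₂ r)) ≗ ρ^ (toℕ r) ∘ g t
      element-reflection r y = trans (·-el _ t y) (element-rotation r (g t y))

      element-rotation≢reflection : ∀ r r′ → element (inj₁ r) ≢ element (inj₂ r′)
      element-rotation≢reflection r r′ eq = rotation≉reflection {toℕ r} (toℕ<n r′) λ y →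
        trans (sym (element-rotation r y)) (trans (cong (λ i → g i y) eq) (element-reflection r′ y))

      element-injective : ∀ {u v} → element u ≡ element v → u ≡ v
      element-injective {inj₁ r} {inj₁ r′} eq = cong inj₁ (toℕ-injective (ρ^-injective (toℕ<n r) (toℕ<n r′) λ y →
        trans (sym (element-rotation r y)) (trans (cong (λ i → g i y) eq) (element-rotation r′ y))))
      element-injective {inj₂ r} {inj₂ r′} eq = cong inj₂ (toℕ-injective (ρ^-injective (toℕ<n r) (toℕ<n r′) λ y → begin
        ρ^ (toℕ r) y                   ≡⟨ cong (ρ^ (toℕ r)) (sym (t-involutive y)) ⟩
        ρ^ (toℕ r) (g t (g t y))       ≡⟨ sym (element-reflection r (g t y)) ⟩
        g (element (inj₂ r)) (g t y)   ≡⟨ cong (λ i → g i (g t y)) eq ⟩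
        g (element (inj₂ r′)) (g t y)  ≡⟨ element-reflection r′ (g t y) ⟩
        ρ^ (toℕ r′) (g t (g t y))      ≡⟨ cong (ρ^ (toℕ r′)) (t-involutive y) ⟩
        ρ^ (toℕ r′) y                  ∎))
      element-injective {inj₁ r} {inj₂ r′} eq = contradiction eq (element-rotation≢reflection r r′)
      element-injective {inj₂ r} {inj₁ r′} eq = contradiction (sym eq) (element-rotation≢reflection r′ r)

      element-surjective : ∀ j → ∃ λ u → element u ≡ j
      element-surjective j with rotation-or-reflection j
      ... | q , inj₁ gj≗ρ^q = inj₁ (reduce q) , ≗⇒≡ λ y →
        trans (element-rotation (reduce q) y) (sym (trans (gj≗ρ^q y) (ρ^-reduce q y)))
      ... | q , inj₂ gj≗ρ^qt = inj₂ (reduce q) , ≗⇒≡ λ y →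
        trans (element-reflection (reduce q) y) (sym (trans (gj≗ρ^qt y) (ρ^-reduce q (g t y))))

      order≡2o : n ≡ 2 * o
      order≡2o = trans (≤-antisym n≤o+o o+o≤n) (cong (o +_) (sym (+-identityʳ o)))
        where
        preimage : Fin n → Fin o ⊎ Fin o
        preimage j = proj₁ (element-surjective j)
        n≤o+o : n ≤ o + o
        n≤o+o = injective⇒≤ {f = join o o ∘ preimage} λ {i} {j} eq → begin
          i                                    ≡⟨ sym (proj₂ (element-surjective i)) ⟩
          element (preimage i)                 ≡⟨ cong element (sym (splitAt-join o o (preimage i))) ⟩
          element (splitAt o (join o o (preimage i))) ≡⟨ cong (element ∘ splitAt o) eq ⟩
          element (splitAt o (join o o (preimage j))) ≡⟨ cong element (splitAt-join o o (preimage j)) ⟩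
          element (preimage j)                 ≡⟨ proj₂ (element-surjective j) ⟩
          j                                    ∎
        o+o≤n : o + o ≤ n
        o+o≤n = injective⇒≤ {f = element ∘ splitAt o} λ {z} {z′} eq → begin
          z                       ≡⟨ sym (join-splitAt o o z) ⟩
          join o o (splitAt o z)  ≡⟨ cong (join o o) (element-injective {splitAt o z} {splitAt o z′} eq) ⟩
          join o o (splitAt o z′) ≡⟨ join-splitAt o o z′ ⟩
          z′                      ∎

      dihedral : IsDihedral M H
      dihedral = o , order≡2o , ρ , t , ρ^o , t-involutive , tρ-involutive , rotation-or-reflection

    cyclic-or-dihedral : IsCyclic M H ⊎ IsDihedral M H
    cyclic-or-dihedral with all? rotation?
    ... | yes all-rotations = inj₁ (ρ , λ j → toℕ (proj₁ (all-rotations j)) , proj₂ (all-rotations j))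
    ... | no ¬all-rotations = reflection (¬∀⟶∃¬ n IsRotation rotation? ¬all-rotations)
      where
      reflection : (∃ λ t → ¬ IsRotation t) → IsCyclic M H ⊎ IsDihedral M H
      reflection (t , t-not-rotation) with position t
      ... | inj₁ (k , tx) = contradiction (rotation-position⇒IsRotation k tx) t-not-rotation
      ... | inj₂ (s , tx) = inj₂ (Reflection.dihedral t t-not-rotation s tx)

  module _ {p a : ℕ} (p-prime : Prime p) (H : AutSubgroup M) (H-order : order H ≡ p ^ a) where
    open Subgroup H

    fixed-cell-or-p∣size : (C : Cells) → (∃ λ x → Orbits.orbitSize C x ≡ 1) ⊎ p ∣ Cells.size C
    fixed-cell-or-p∣size C with any? (λ x → Orbits.orbitSize C x ℕ.≟ 1)
    ... | yes fixed = inj₁ fixed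
    ... | no ¬fixed = inj₂ (Orbits.orbits-additive C (p ∣_) (p ∣0) ∣m∣n⇒∣m+n p∣orbitSize)
      where
      p∣orbitSize : ∀ x → p ∣ Orbits.orbitSize C x
      p∣orbitSize x with prime-power-divisor p-prime a (subst (_ ∣_) H-order (Orbits.orbitSize∣order C x))
      ... | inj₁ orbit≡1 = contradiction (x , orbit≡1) ¬fixed
      ... | inj₂ p∣orbit = p∣orbit

    p-subgroup-cyclic-or-dihedral : Coprime ∣ χ M ∣ nE → IsCyclic M H ⊎ IsDihedral M H
    p-subgroup-cyclic-or-dihedral coprime
      with fixed-cell-or-p∣size vertices | fixed-cell-or-p∣size edges | fixed-cell-or-p∣size faces
    ... | inj₁ (x , fixed) | _ | _ = CellStabilizer.cyclic-or-dihedral H vertices x (Orbits.orbitSize≡1⇒fixed vertices fixed)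
    ... | inj₂ _ | inj₁ (x , fixed) | _ = CellStabilizer.cyclic-or-dihedral H edges x (Orbits.orbitSize≡1⇒fixed edges fixed)
    ... | inj₂ _ | inj₂ _ | inj₁ (x , fixed) = CellStabilizer.cyclic-or-dihedral H faces x (Orbits.orbitSize≡1⇒fixed faces fixed)
    ... | inj₂ p∣nV | inj₂ p∣nE | inj₂ p∣nF =
      contradiction (common-divisor-of-cells≡1 coprime p∣nV p∣nE p∣nF) (nonTrivial⇒≢1 {{prime⇒nonTrivial p-prime}})

lemma3p2 : (M : Map) (G : AutSubgroup M) →
    gcd (∣ χ M ∣) (Map.nE M) ≡ 1 →
      (gcd (∣ χ M ∣) (order G) ∣ 4
        × (gcd (∣ χ M ∣) (order G) ≢ 1 → ¬ (2 ∣ Map.nE M)))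
    × (∀ (p : ℕ) (H : AutSubgroup M) → IsSylow M p G H → IsCyclic M H ⊎ IsDihedral M H)
    × order G ≡ lcmStab M G
lemma3p2 M G gcd≡1 =
    (gcd-χ-order∣4 M G coprime , gcd-χ-order≢1⇒nE-odd M G coprime)
  , (λ { p H (p-prime , _ , a , H-order , _) → p-subgroup-cyclic-or-dihedral M {a = a} p-prime H H-order coprime })
  , order≡lcmStab M G coprime
  where
  coprime : Coprime ∣ χ M ∣ (Map.nE M)
  coprime = gcd≡1⇒coprime gcd≡1
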